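{- For every positive integer $n$ and every integer $k$ with $n \le 2^k$, \[ \tilde{F}\!\left(\frac{n}{2^k}\right) \;=\; \frac{n k - 2B(n)}{2^k}. \]
   Context: For a real number $x$, $\mathrm{Zigzag}(x) = \min\left(x - \lfloor x \rfloor,\ \lceil x \rceil - x\right)$. The function $\tilde{F}:\mathbb{R}\to\mathbb{R}$ (the Blancmange/Takagi function) is $\tilde{F}(x) = \sum_{i=0}^{\infty} 2^{ -i}\, \mathrm{Zigzag}(2^i x)$. $B$ is the function on positive integers defined by $B(1) = 0$ and, for $n \ge 2$, $B(n) = \lfloor n/2 \rfloor + B(\lfloor n/2 \rfloor) + B(\lceil n/2 \rceil)$ (the minimum number of key comparisons of MergeSort on $n$ elements). -}

module Defs where

open import Data.Nat as ℕ using (ℕ; zero; suc; ⌊_/2⌋; ⌈_/2⌉)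
open import Data.Integer as ℤ using (ℤ; +_)
open import Data.Rational using (ℚ; _+_; _*_; _-_; _⊓_; floor; ceiling; ½; 0ℚ; 1ℚ; _/_)

ℕ→ℚ : ℕ → ℚ
ℕ→ℚ n = + n / 1

ℤ→ℚ : ℤ → ℚ
ℤ→ℚ z = z / 1

Zigzag : ℚ → ℚ
Zigzag x = (x - ℤ→ℚ (floor x)) ⊓ (ℤ→ℚ (ceiling x) - x)

pow2 : ℕ → ℚ
pow2 zero    = 1ℚ
pow2 (suc i) = ℕ→ℚ 2 * pow2 i

pow½ : ℕ → ℚ
pow½ zero    = 1ℚ
pow½ (suc i) = ½ * pow½ i

takagiPartial : ℕ → ℚ → ℚ
takagiPartial zero    x = 0ℚ
takagiPartial (suc N) x = takagiPartial N x + pow½ N * Zigzag (pow2 N * x)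

-- B(1) = 0, B(n) = ⌊n/2⌋ + B(⌊n/2⌋) + B(⌈n/2⌉) for n ≥ 2.
-- Implemented with a fuel argument (fuel n suffices); B 0 = 0 is a junk value.
Bfuel : ℕ → ℕ → ℕ
Bfuel zero    n = 0
Bfuel (suc f) zero = 0
Bfuel (suc f) (suc zero) = 0
Bfuel (suc f) n@(suc (suc _)) = ⌊ n /2⌋ ℕ.+ Bfuel f ⌊ n /2⌋ ℕ.+ Bfuel f ⌈ n /2⌉

B : ℕ → ℕ
B n = Bfuel n n

module Submission where

-- Write d_j(m) for the distance from m to the nearest multiple of 2^j.  At x = n/2^k the
-- i-th term of the Takagi series is 2^(-k) d_(k-i)(n), which vanishes for i ≥ k, so every
-- partial sum with N ≥ k equals 2^(-k) S_k(n), where S_k(n) = d_1(n) + ... + d_k(n).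
-- Since d_1(n) = n mod 2 and d_(j+1)(n) = d_j(⌊n/2⌋) + d_j(⌈n/2⌉) for j ≥ 1, S_k satisfies
-- S_(k+1)(n) = (n mod 2) + S_k(⌊n/2⌋) + S_k(⌈n/2⌉), the halving recursion of MergeSort's
-- count B, and induction on k gives S_k(n) + 2 B(n) = n k whenever n ≤ 2^k.

open import Defs

module DyadicDistance where

  open import Data.Nat
    using (ℕ; zero; suc; _+_; _*_; _∸_; _^_; _≤_; _⊓_; ⌊_/2⌋; ⌈_/2⌉; s≤s; s≤s⁻¹)
  open import Data.Nat.Properties
  open import Data.Nat.Solver using (module +-*-Solver)
  open import Relation.Binary.PropositionalEquality
  open import Relation.Binary.Definitions using (tri<; tri≈; tri>)
  open import Relation.Nullary using (contradiction)
  open +-*-Solver using (solve; _:+_; _:*_; _:=_; con)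

  data ParityView : ℕ → Set where
    even : ∀ a → ParityView (a + a)
    odd  : ∀ a → ParityView (suc (a + a))

  parityView : ∀ n → ParityView n
  parityView zero = even 0
  parityView (suc n) with parityView n
  ... | even a = odd a
  ... | odd a  = subst ParityView (cong suc (+-suc a a)) (even (suc a))

  ⌊n+n/2⌋≡n : ∀ n → ⌊ n + n /2⌋ ≡ n
  ⌊n+n/2⌋≡n n = sym (n≡⌊n+n/2⌋ n)

  ⌈n+n/2⌉≡n : ∀ n → ⌈ n + n /2⌉ ≡ n
  ⌈n+n/2⌉≡n n = sym (n≡⌈n+n/2⌉ n)

  n+n-injective : ∀ {m n} → m + m ≡ n + n → m ≡ n
  n+n-injective {m} {n} eq = trans (sym (⌊n+n/2⌋≡n m)) (trans (cong ⌊_/2⌋ eq) (⌊n+n/2⌋≡n n))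

  m+m≢1+n+n : ∀ m n → m + m ≢ suc (n + n)
  m+m≢1+n+n m n eq = 1+n≢n (trans (sym m≡1+n) m≡n)
    where
    m≡n : m ≡ n
    m≡n = trans (sym (⌊n+n/2⌋≡n m)) (trans (cong ⌊_/2⌋ eq) (⌈n+n/2⌉≡n n))
    m≡1+n : m ≡ suc n
    m≡1+n = trans (sym (⌈n+n/2⌉≡n m)) (trans (cong ⌈_/2⌉ eq) (cong suc (⌊n+n/2⌋≡n n)))

  2^[1+n]≡2^n+2^n : ∀ n → 2 ^ suc n ≡ 2 ^ n + 2 ^ n
  2^[1+n]≡2^n+2^n n = cong (2 ^ n +_) (+-identityʳ (2 ^ n))

  -- d_j of the header; dist2^-spec identifies it with the distance to the nearest multiple of 2 ^ j.
  dist2^ : ℕ → ℕ → ℕ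
  dist2^ zero          m = 0
  dist2^ (suc zero)    m = ⌈ m /2⌉ ∸ ⌊ m /2⌋
  dist2^ (suc (suc j)) m = dist2^ (suc j) ⌊ m /2⌋ + dist2^ (suc j) ⌈ m /2⌉

  dist2^-double : ∀ j n → dist2^ (suc j) (n + n) ≡ dist2^ j n + dist2^ j n
  dist2^-double zero    n rewrite ⌊n+n/2⌋≡n n | ⌈n+n/2⌉≡n n = n∸n≡0 n
  dist2^-double (suc j) n rewrite ⌊n+n/2⌋≡n n | ⌈n+n/2⌉≡n n = refl

  dist2^-suc-double : ∀ j n →
    dist2^ (suc (suc j)) (suc (n + n)) ≡ dist2^ (suc j) n + dist2^ (suc j) (suc n)
  dist2^-suc-double j n rewrite ⌊n+n/2⌋≡n n | ⌈n+n/2⌉≡n n = refl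

  dist2^-one-suc-double : ∀ n → dist2^ 1 (suc (n + n)) ≡ 1
  dist2^-one-suc-double n rewrite ⌊n+n/2⌋≡n n | ⌈n+n/2⌉≡n n = m+n∸n≡m 1 n

  m⊓n+m⊓n≡[m+m]⊓[n+n] : ∀ m n → m ⊓ n + m ⊓ n ≡ (m + m) ⊓ (n + n)
  m⊓n+m⊓n≡[m+m]⊓[n+n] = mono-≤-distrib-⊓ {f = λ x → x + x} (λ p → +-mono-≤ p p)

  m⊓[1+n]+[1+m]⊓n≡[1+m+m]⊓[1+n+n] : ∀ {m n} → m ≢ n →
    m ⊓ suc n + suc m ⊓ n ≡ suc (m + m) ⊓ suc (n + n)
  m⊓[1+n]+[1+m]⊓n≡[1+m+m]⊓[1+n+n] {m} {n} m≢n with <-cmp m n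
  ... | tri< m<n _ _ rewrite m≤n⇒m⊓n≡m (m≤n⇒m≤1+n (<⇒≤ m<n)) | m≤n⇒m⊓n≡m m<n
                           | m≤n⇒m⊓n≡m (s≤s (+-mono-≤ (<⇒≤ m<n) (<⇒≤ m<n))) = +-suc m m
  ... | tri≈ _ m≡n _ = contradiction m≡n m≢n
  ... | tri> _ _ n<m rewrite m≥n⇒m⊓n≡n n<m | m≥n⇒m⊓n≡n (m≤n⇒m≤1+n (<⇒≤ n<m))
                           | m≥n⇒m⊓n≡n (s≤s (+-mono-≤ (<⇒≤ n<m) (<⇒≤ n<m))) = refl

  q*2^[1+j]+[m+m] : ∀ q j m → q * 2 ^ suc j + (m + m) ≡ (q * 2 ^ j + m) + (q * 2 ^ j + m)
  q*2^[1+j]+[m+m] q j m =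
    solve 3 (λ q p m → q :* (con 2 :* p) :+ (m :+ m) := (q :* p :+ m) :+ (q :* p :+ m)) refl q (2 ^ j) m

  q*2^[1+j]+[1+m+m] : ∀ q j m → q * 2 ^ suc j + suc (m + m) ≡ suc ((q * 2 ^ j + m) + (q * 2 ^ j + m))
  q*2^[1+j]+[1+m+m] q j m =
    solve 3 (λ q p m → q :* (con 2 :* p) :+ (con 1 :+ (m :+ m)) := con 1 :+ ((q :* p :+ m) :+ (q :* p :+ m))) refl q (2 ^ j) m

  [m+m]+[n+n]≡2^[1+j]⇒m+n≡2^j : ∀ m n j → (m + m) + (n + n) ≡ 2 ^ suc j → m + n ≡ 2 ^ j
  [m+m]+[n+n]≡2^[1+j]⇒m+n≡2^j m n j eq = n+n-injective (begin
    (m + n) + (m + n) ≡⟨ solve 2 (λ m n → (m :+ n) :+ (m :+ n) := (m :+ m) :+ (n :+ n)) refl m n ⟩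
    (m + m) + (n + n) ≡⟨ eq ⟩
    2 ^ suc j         ≡⟨ 2^[1+n]≡2^n+2^n j ⟩
    2 ^ j + 2 ^ j     ∎)
    where open ≡-Reasoning

  [1+m+m]+[1+n+n]≡2^[1+j]⇒1+m+n≡2^j : ∀ m n j → suc (m + m) + suc (n + n) ≡ 2 ^ suc j → suc (m + n) ≡ 2 ^ j
  [1+m+m]+[1+n+n]≡2^[1+j]⇒1+m+n≡2^j m n j eq = n+n-injective (begin
    suc (m + n) + suc (m + n)
      ≡⟨ solve 2 (λ m n → (con 1 :+ m :+ n) :+ (con 1 :+ m :+ n) := (con 1 :+ (m :+ m)) :+ (con 1 :+ (n :+ n))) refl m n ⟩
    suc (m + m) + suc (n + n)   ≡⟨ eq ⟩
    2 ^ suc j                   ≡⟨ 2^[1+n]≡2^n+2^n j ⟩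
    2 ^ j + 2 ^ j               ∎)
    where open ≡-Reasoning

  [m+m]+[1+n+n]≢2^[1+j] : ∀ m n j → (m + m) + suc (n + n) ≢ 2 ^ suc j
  [m+m]+[1+n+n]≢2^[1+j] m n j eq = m+m≢1+n+n (2 ^ j) (m + n) (begin
    2 ^ j + 2 ^ j               ≡⟨ 2^[1+n]≡2^n+2^n j ⟨
    2 ^ suc j                   ≡⟨ eq ⟨
    (m + m) + suc (n + n)       ≡⟨ solve 2 (λ m n → (m :+ m) :+ (con 1 :+ (n :+ n)) := con 1 :+ ((m :+ n) :+ (m :+ n))) refl m n ⟩
    suc ((m + n) + (m + n))     ∎)
    where open ≡-Reasoning

  dist2^-spec : ∀ j q {r s} → r + s ≡ 2 ^ j → dist2^ j (q * 2 ^ j + r) ≡ r ⊓ s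
  dist2^-spec zero q {zero}             _ = refl
  dist2^-spec zero q {suc r} {zero}     _ = refl
  dist2^-spec zero q {suc zero} {suc s} ()
  dist2^-spec zero q {suc (suc r)}      ()
  dist2^-spec (suc j) q {r} {s} r+s≡2^[1+j] with parityView r | parityView s
  ... | even a | even b = begin
    dist2^ (suc j) (q * 2 ^ suc j + (a + a)) ≡⟨ cong (dist2^ (suc j)) (q*2^[1+j]+[m+m] q j a) ⟩
    dist2^ (suc j) (x + x)                   ≡⟨ dist2^-double j x ⟩
    dist2^ j x + dist2^ j x                  ≡⟨ cong (λ d → d + d) (dist2^-spec j q a+b≡2^j) ⟩
    a ⊓ b + a ⊓ b                            ≡⟨ m⊓n+m⊓n≡[m+m]⊓[n+n] a b ⟩
    (a + a) ⊓ (b + b)                        ∎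
    where
    open ≡-Reasoning
    x : ℕ
    x = q * 2 ^ j + a
    a+b≡2^j : a + b ≡ 2 ^ j
    a+b≡2^j = [m+m]+[n+n]≡2^[1+j]⇒m+n≡2^j a b j r+s≡2^[1+j]
  ... | even a | odd b = contradiction r+s≡2^[1+j] ([m+m]+[1+n+n]≢2^[1+j] a b j)
  ... | odd a | even b =
    contradiction (trans (+-comm (b + b) (suc (a + a))) r+s≡2^[1+j]) ([m+m]+[1+n+n]≢2^[1+j] b a j)
  dist2^-spec (suc zero) q r+s≡2 | odd a | odd b = begin
    dist2^ 1 (q * 2 ^ 1 + suc (a + a)) ≡⟨ cong (dist2^ 1) (q*2^[1+j]+[1+m+m] q 0 a) ⟩
    dist2^ 1 (suc (x + x))             ≡⟨ dist2^-one-suc-double x ⟩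
    1                                  ≡⟨ cong₂ (λ a b → suc (a + a) ⊓ suc (b + b)) a≡0 b≡0 ⟨
    suc (a + a) ⊓ suc (b + b)          ∎
    where
    open ≡-Reasoning
    x : ℕ
    x = q * 1 + a
    a+b≡0 : a + b ≡ 0
    a+b≡0 = suc-injective ([1+m+m]+[1+n+n]≡2^[1+j]⇒1+m+n≡2^j a b 0 r+s≡2)
    a≡0 : a ≡ 0
    a≡0 = m+n≡0⇒m≡0 a a+b≡0
    b≡0 : b ≡ 0
    b≡0 = m+n≡0⇒n≡0 a a+b≡0
  dist2^-spec (suc (suc j)) q r+s≡2^[2+j] | odd a | odd b = begin
    dist2^ (2 + j) (q * 2 ^ (2 + j) + suc (a + a)) ≡⟨ cong (dist2^ (2 + j)) (q*2^[1+j]+[1+m+m] q (suc j) a) ⟩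
    dist2^ (2 + j) (suc (x + x))                   ≡⟨ dist2^-suc-double j x ⟩
    dist2^ (1 + j) x + dist2^ (1 + j) (suc x)       ≡⟨ cong (λ y → dist2^ (1 + j) x + dist2^ (1 + j) y) (+-suc (q * 2 ^ suc j) a) ⟨
    dist2^ (1 + j) x + dist2^ (1 + j) (q * 2 ^ suc j + suc a)
      ≡⟨ cong₂ _+_ (dist2^-spec (suc j) q (trans (+-suc a b) 1+a+b≡2^[1+j])) (dist2^-spec (suc j) q 1+a+b≡2^[1+j]) ⟩
    a ⊓ suc b + suc a ⊓ b                           ≡⟨ m⊓[1+n]+[1+m]⊓n≡[1+m+m]⊓[1+n+n] a≢b ⟩
    suc (a + a) ⊓ suc (b + b)                       ∎
    where
    open ≡-Reasoning
    x : ℕ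
    x = q * 2 ^ suc j + a
    1+a+b≡2^[1+j] : suc (a + b) ≡ 2 ^ suc j
    1+a+b≡2^[1+j] = [1+m+m]+[1+n+n]≡2^[1+j]⇒1+m+n≡2^j a b (suc j) r+s≡2^[2+j]
    a≢b : a ≢ b
    a≢b refl = m+m≢1+n+n (2 ^ j) a (sym (trans 1+a+b≡2^[1+j] (2^[1+n]≡2^n+2^n j)))

  Bfuel-irrelevant : ∀ {f g} m → m ≤ f → m ≤ g → Bfuel f m ≡ Bfuel g m
  Bfuel-irrelevant {zero}  {zero}  zero _ _ = refl
  Bfuel-irrelevant {zero}  {suc g} zero _ _ = refl
  Bfuel-irrelevant {suc f} {zero}  zero _ _ = refl
  Bfuel-irrelevant {suc f} {suc g} zero _ _ = refl
  Bfuel-irrelevant {suc f} {suc g} (suc zero) _ _ = refl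
  Bfuel-irrelevant {suc f} {suc g} m@(suc (suc m′)) m≤1+f m≤1+g =
    cong₂ (λ x y → ⌊ m /2⌋ + x + y)
      (Bfuel-irrelevant ⌊ m /2⌋ (⌊m/2⌋≤ m≤1+f) (⌊m/2⌋≤ m≤1+g))
      (Bfuel-irrelevant ⌈ m /2⌉ (⌈m/2⌉≤ m≤1+f) (⌈m/2⌉≤ m≤1+g))
    where
    ⌊m/2⌋≤ : ∀ {h} → m ≤ suc h → ⌊ m /2⌋ ≤ h
    ⌊m/2⌋≤ m≤1+h = s≤s⁻¹ (<-≤-trans (⌊n/2⌋<n (suc m′)) m≤1+h)
    ⌈m/2⌉≤ : ∀ {h} → m ≤ suc h → ⌈ m /2⌉ ≤ h
    ⌈m/2⌉≤ m≤1+h = s≤s⁻¹ (<-≤-trans (⌈n/2⌉<n m′) m≤1+h)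

  B-halving : ∀ n → B n ≡ ⌊ n /2⌋ + B ⌊ n /2⌋ + B ⌈ n /2⌉
  B-halving zero = refl
  B-halving (suc zero) = refl
  B-halving n@(suc (suc m)) =
    cong₂ (λ x y → ⌊ n /2⌋ + x + y)
      (Bfuel-irrelevant ⌊ n /2⌋ (s≤s⁻¹ (⌊n/2⌋<n (suc m))) ≤-refl)
      (Bfuel-irrelevant ⌈ n /2⌉ (s≤s⁻¹ (⌈n/2⌉<n m)) ≤-refl)

  scaledTakagi : ℕ → ℕ → ℕ
  scaledTakagi zero    n = 0
  scaledTakagi (suc k) n = scaledTakagi k n + dist2^ (suc k) n

  scaledTakagi-halving : ∀ k n →
    scaledTakagi (suc k) n ≡ dist2^ 1 n + scaledTakagi k ⌊ n /2⌋ + scaledTakagi k ⌈ n /2⌉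
  scaledTakagi-halving zero    n = sym (trans (+-identityʳ (dist2^ 1 n + 0)) (+-identityʳ (dist2^ 1 n)))
  scaledTakagi-halving (suc k) n = begin
    scaledTakagi (suc k) n + dist2^ (2 + k) n
      ≡⟨ cong (_+ dist2^ (2 + k) n) (scaledTakagi-halving k n) ⟩
    d + T⌊⌋ + T⌈⌉ + (dist2^ (suc k) ⌊ n /2⌋ + dist2^ (suc k) ⌈ n /2⌉)
      ≡⟨ solve 5 (λ d t t′ e e′ → d :+ t :+ t′ :+ (e :+ e′) := d :+ (t :+ e) :+ (t′ :+ e′)) refl
           d T⌊⌋ T⌈⌉ (dist2^ (suc k) ⌊ n /2⌋) (dist2^ (suc k) ⌈ n /2⌉) ⟩
    d + scaledTakagi (suc k) ⌊ n /2⌋ + scaledTakagi (suc k) ⌈ n /2⌉ ∎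
    where
    open ≡-Reasoning
    d T⌊⌋ T⌈⌉ : ℕ
    d = dist2^ 1 n
    T⌊⌋ = scaledTakagi k ⌊ n /2⌋
    T⌈⌉ = scaledTakagi k ⌈ n /2⌉

  dist2^-one+⌊n/2⌋+⌊n/2⌋≡n : ∀ n → dist2^ 1 n + ⌊ n /2⌋ + ⌊ n /2⌋ ≡ n
  dist2^-one+⌊n/2⌋+⌊n/2⌋≡n n = begin
    ⌈ n /2⌉ ∸ ⌊ n /2⌋ + ⌊ n /2⌋ + ⌊ n /2⌋ ≡⟨ cong (_+ ⌊ n /2⌋) (m∸n+n≡m (⌊n/2⌋≤⌈n/2⌉ n)) ⟩
    ⌈ n /2⌉ + ⌊ n /2⌋                     ≡⟨ +-comm ⌈ n /2⌉ ⌊ n /2⌋ ⟩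
    ⌊ n /2⌋ + ⌈ n /2⌉                     ≡⟨ ⌊n/2⌋+⌈n/2⌉≡n n ⟩
    n                                     ∎
    where open ≡-Reasoning

  scaledTakagi+2B≡n*k : ∀ k n → n ≤ 2 ^ k → scaledTakagi k n + 2 * B n ≡ n * k
  scaledTakagi+2B≡n*k zero zero          _ = refl
  scaledTakagi+2B≡n*k zero (suc zero)    _ = refl
  scaledTakagi+2B≡n*k zero (suc (suc n)) (s≤s ())
  scaledTakagi+2B≡n*k (suc k) n n≤2^[1+k] = begin
    scaledTakagi (suc k) n + 2 * B n
      ≡⟨ cong₂ (λ t b → t + 2 * b) (scaledTakagi-halving k n) (B-halving n) ⟩
    dist2^ 1 n + T h + T c + 2 * (h + B h + B c)
      ≡⟨ solve 6 (λ d t t′ h b b′ → d :+ t :+ t′ :+ con 2 :* (h :+ b :+ b′)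
                                  := (t :+ con 2 :* b) :+ (t′ :+ con 2 :* b′) :+ (d :+ h :+ h))
               refl (dist2^ 1 n) (T h) (T c) h (B h) (B c) ⟩
    (T h + 2 * B h) + (T c + 2 * B c) + (dist2^ 1 n + h + h)
      ≡⟨ cong₂ _+_ (cong₂ _+_ (scaledTakagi+2B≡n*k k h h≤2^k) (scaledTakagi+2B≡n*k k c c≤2^k))
                   (dist2^-one+⌊n/2⌋+⌊n/2⌋≡n n) ⟩
    h * k + c * k + n
      ≡⟨ cong (_+ n) (*-distribʳ-+ k h c) ⟨
    (h + c) * k + n
      ≡⟨ cong (λ m → m * k + n) (⌊n/2⌋+⌈n/2⌉≡n n) ⟩
    n * k + n
      ≡⟨ trans (*-suc n k) (+-comm n (n * k)) ⟨
    n * suc k ∎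
    where
    open ≡-Reasoning
    T : ℕ → ℕ
    T = scaledTakagi k
    h c : ℕ
    h = ⌊ n /2⌋
    c = ⌈ n /2⌉
    c≤2^k : c ≤ 2 ^ k
    c≤2^k = subst (c ≤_) (trans (cong ⌈_/2⌉ (2^[1+n]≡2^n+2^n k)) (⌈n+n/2⌉≡n (2 ^ k)))
                  (⌈n/2⌉-mono n≤2^[1+k])
    h≤2^k : h ≤ 2 ^ k
    h≤2^k = ≤-trans (⌊n/2⌋≤⌈n/2⌉ n) c≤2^k


module TakagiPartialSums where

  open import Data.Nat as ℕ using (ℕ; zero; suc)
  import Data.Nat.Properties as ℕP
  open import Data.Nat.Coprimality using (Coprime; 1-coprimeTo)
  import Data.Nat.Coprimality as Coprimality
  open import Data.Nat.DivMod using (_/_; _%_; m%n<n; m≡m%n+[m/n]*n)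
  open import Data.Integer as ℤ using (ℤ; +_)
  import Data.Integer.Properties as ℤP
  open import Data.Integer.DivMod using (_/ℕ_; div-pos-is-/ℕ; [n/ℕd]*d≤n; n<s[n/ℕd]*d)
  import Data.Integer.Solver as ℤ-Solver
  open import Data.Rational
    using (ℚ; mkℚ; _+_; _*_; _-_; -_; _≤_; _<_; _⊓_; floor; ceiling; ½; 0ℚ; 1ℚ; *≤*; *<*; Positive)
  open import Data.Rational.Properties
  import Data.Rational.Unnormalised as ℚᵘ
  import Data.Rational.Unnormalised.Properties as ℚᵘ
  import Data.Rational.Solver as QSolver
  open import Data.Sum using (inj₁; inj₂)
  open import Function using (_∘_)
  open import Relation.Binary.PropositionalEquality
  open DyadicDistance using (dist2^; dist2^-spec; scaledTakagi; scaledTakagi+2B≡n*k)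

  ∣z∣-coprime-1 : ∀ z → Coprime ℤ.∣ z ∣ 1
  ∣z∣-coprime-1 z = Coprimality.sym (1-coprimeTo ℤ.∣ z ∣)

  mkℚ/1 : ℤ → ℚ
  mkℚ/1 z = mkℚ z 0 (∣z∣-coprime-1 z)

  ℤ→ℚ≡mkℚ/1 : ∀ z → ℤ→ℚ z ≡ mkℚ/1 z
  ℤ→ℚ≡mkℚ/1 (+ n)       = normalize-coprime (∣z∣-coprime-1 (+ n))
  ℤ→ℚ≡mkℚ/1 ℤ.-[1+ n ] = cong -_ (normalize-coprime (∣z∣-coprime-1 (+ suc n)))

  ℤ→ℚ-homo-+ : ∀ a b → ℤ→ℚ (a ℤ.+ b) ≡ ℤ→ℚ a + ℤ→ℚ b
  ℤ→ℚ-homo-+ a b rewrite ℤ→ℚ≡mkℚ/1 (a ℤ.+ b) | ℤ→ℚ≡mkℚ/1 a | ℤ→ℚ≡mkℚ/1 b =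
    toℚᵘ-injective (ℚᵘ.≃-trans (ℚᵘ.*≡* cross-multiplied) (ℚᵘ.≃-sym (toℚᵘ-homo-+ (mkℚ/1 a) (mkℚ/1 b))))
    where
    open ℤ-Solver.+-*-Solver
    cross-multiplied : (a ℤ.+ b) ℤ.* (ℤ.1ℤ ℤ.* ℤ.1ℤ) ≡ (a ℤ.* ℤ.1ℤ ℤ.+ b ℤ.* ℤ.1ℤ) ℤ.* ℤ.1ℤ
    cross-multiplied =
      solve 2 (λ a b → (a :+ b) :* (con ℤ.1ℤ :* con ℤ.1ℤ) := (a :* con ℤ.1ℤ :+ b :* con ℤ.1ℤ) :* con ℤ.1ℤ) refl a b

  ℤ→ℚ-homo-* : ∀ a b → ℤ→ℚ (a ℤ.* b) ≡ ℤ→ℚ a * ℤ→ℚ b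
  ℤ→ℚ-homo-* a b rewrite ℤ→ℚ≡mkℚ/1 (a ℤ.* b) | ℤ→ℚ≡mkℚ/1 a | ℤ→ℚ≡mkℚ/1 b =
    toℚᵘ-injective (ℚᵘ.≃-trans (ℚᵘ.*≡* cross-multiplied) (ℚᵘ.≃-sym (toℚᵘ-homo-* (mkℚ/1 a) (mkℚ/1 b))))
    where
    open ℤ-Solver.+-*-Solver
    cross-multiplied : (a ℤ.* b) ℤ.* (ℤ.1ℤ ℤ.* ℤ.1ℤ) ≡ (a ℤ.* b) ℤ.* ℤ.1ℤ
    cross-multiplied = solve 2 (λ a b → (a :* b) :* (con ℤ.1ℤ :* con ℤ.1ℤ) := (a :* b) :* con ℤ.1ℤ) refl a b

  ℤ→ℚ-homo‿- : ∀ a → ℤ→ℚ (ℤ.- a) ≡ - ℤ→ℚ a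
  ℤ→ℚ-homo‿- a rewrite ℤ→ℚ≡mkℚ/1 (ℤ.- a) | ℤ→ℚ≡mkℚ/1 a =
    toℚᵘ-injective (ℚᵘ.≃-sym (toℚᵘ-homo‿- (mkℚ/1 a)))

  ℤ→ℚ-mono-≤ : ∀ {a b} → a ℤ.≤ b → ℤ→ℚ a ≤ ℤ→ℚ b
  ℤ→ℚ-mono-≤ {a} {b} a≤b rewrite ℤ→ℚ≡mkℚ/1 a | ℤ→ℚ≡mkℚ/1 b =
    *≤* (subst₂ ℤ._≤_ (sym (ℤP.*-identityʳ a)) (sym (ℤP.*-identityʳ b)) a≤b)

  ℤ→ℚ-mono-< : ∀ {a b} → a ℤ.< b → ℤ→ℚ a < ℤ→ℚ b
  ℤ→ℚ-mono-< {a} {b} a<b rewrite ℤ→ℚ≡mkℚ/1 a | ℤ→ℚ≡mkℚ/1 b =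
    *<* (subst₂ ℤ._<_ (sym (ℤP.*-identityʳ a)) (sym (ℤP.*-identityʳ b)) a<b)

  /ℕ-unique : ∀ {z n} d .{{_ : ℕ.NonZero d}} → z ℤ.* + d ℤ.≤ n → n ℤ.< ℤ.suc z ℤ.* + d → n /ℕ d ≡ z
  /ℕ-unique {z} {n} d zd≤n n<[1+z]d = ℤP.≤-antisym (<suc⇒≤ q<1+z) (<suc⇒≤ z<1+q)
    where
    q : ℤ
    q = n /ℕ d
    <suc⇒≤ : ∀ {i j} → i ℤ.< ℤ.suc j → i ℤ.≤ j
    <suc⇒≤ i<1+j = ℤP.≮⇒≥ (λ j<i → ℤP.<⇒≱ i<1+j (ℤP.i<j⇒suc[i]≤j j<i))
    z<1+q : z ℤ.< ℤ.suc q
    z<1+q = ℤP.*-cancelʳ-<-nonNeg (+ d) (ℤP.≤-<-trans zd≤n (n<s[n/ℕd]*d n d))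
    q<1+z : q ℤ.< ℤ.suc z
    q<1+z = ℤP.*-cancelʳ-<-nonNeg (+ d) (ℤP.≤-<-trans ([n/ℕd]*d≤n n d) n<[1+z]d)

  floor-unique : ∀ z p → ℤ→ℚ z ≤ p → p < ℤ→ℚ (ℤ.suc z) → floor p ≡ z
  floor-unique z p@(mkℚ n d _) z≤p p<1+z
    rewrite ℤ→ℚ≡mkℚ/1 z | ℤ→ℚ≡mkℚ/1 (ℤ.suc z) with z≤p | p<1+z
  ... | *≤* zd≤n | *<* n<[1+z]d = trans (div-pos-is-/ℕ n (suc d))
    (/ℕ-unique (suc d) (subst (_ ℤ.≤_) (ℤP.*-identityʳ n) zd≤n)
                       (subst (ℤ._< _) (ℤP.*-identityʳ n) n<[1+z]d))

  ceiling-unique : ∀ z p → ℤ→ℚ z < p → p ≤ ℤ→ℚ (ℤ.suc z) → ceiling p ≡ ℤ.suc z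
  ceiling-unique z p@(mkℚ _ _ _) z<p p≤1+z = trans (cong ℤ.-_ ⌊-p⌋≡-[1+z]) (ℤP.neg-involutive (ℤ.suc z))
    where
    open ℤ-Solver.+-*-Solver
    1+-[1+z]≡-z : ℤ.suc (ℤ.- ℤ.suc z) ≡ ℤ.- z
    1+-[1+z]≡-z = solve 1 (λ z → con ℤ.1ℤ :+ (:- (con ℤ.1ℤ :+ z)) := :- z) refl z
    ⌊-p⌋≡-[1+z] : floor (- p) ≡ ℤ.- ℤ.suc z
    ⌊-p⌋≡-[1+z] = floor-unique (ℤ.- ℤ.suc z) (- p)
      (subst (_≤ - p) (sym (ℤ→ℚ-homo‿- (ℤ.suc z))) (neg-antimono-≤ p≤1+z))
      (subst (- p <_) (sym (trans (cong ℤ→ℚ 1+-[1+z]≡-z) (ℤ→ℚ-homo‿- z))) (neg-antimono-< z<p))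

  ℤ→ℚ-<-suc : ∀ z → ℤ→ℚ z < ℤ→ℚ (ℤ.suc z)
  ℤ→ℚ-<-suc z = ℤ→ℚ-mono-< {z} (ℤP.suc[i]≤j⇒i<j ℤP.≤-refl)

  floor-ℤ→ℚ : ∀ z → floor (ℤ→ℚ z) ≡ z
  floor-ℤ→ℚ z = floor-unique z (ℤ→ℚ z) ≤-refl (ℤ→ℚ-<-suc z)

  ceiling-ℤ→ℚ : ∀ z → ceiling (ℤ→ℚ z) ≡ z
  ceiling-ℤ→ℚ z = trans (ceiling-unique (ℤ.pred z) (ℤ→ℚ z) pred-z<z z≤1+pred-z) (ℤP.suc-pred z)
    where
    pred-z<z : ℤ→ℚ (ℤ.pred z) < ℤ→ℚ z
    pred-z<z = subst (λ w → ℤ→ℚ (ℤ.pred z) < ℤ→ℚ w) (ℤP.suc-pred z) (ℤ→ℚ-<-suc (ℤ.pred z))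
    z≤1+pred-z : ℤ→ℚ z ≤ ℤ→ℚ (ℤ.suc (ℤ.pred z))
    z≤1+pred-z = ≤-reflexive (cong ℤ→ℚ (sym (ℤP.suc-pred z)))

  ℕ→ℚ-homo-+ : ∀ m n → ℕ→ℚ (m ℕ.+ n) ≡ ℕ→ℚ m + ℕ→ℚ n
  ℕ→ℚ-homo-+ m n = trans (cong ℤ→ℚ (ℤP.pos-+ m n)) (ℤ→ℚ-homo-+ (+ m) (+ n))

  ℕ→ℚ-homo-* : ∀ m n → ℕ→ℚ (m ℕ.* n) ≡ ℕ→ℚ m * ℕ→ℚ n
  ℕ→ℚ-homo-* m n = trans (cong ℤ→ℚ (ℤP.pos-* m n)) (ℤ→ℚ-homo-* (+ m) (+ n))

  ℕ→ℚ-homo-⊓ : ∀ m n → ℕ→ℚ (m ℕ.⊓ n) ≡ ℕ→ℚ m ⊓ ℕ→ℚ n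
  ℕ→ℚ-homo-⊓ m n with ℕP.≤-total m n
  ... | inj₁ m≤n rewrite ℕP.m≤n⇒m⊓n≡m m≤n = sym (p≤q⇒p⊓q≡p (ℤ→ℚ-mono-≤ (ℤ.+≤+ m≤n)))
  ... | inj₂ n≤m rewrite ℕP.m≥n⇒m⊓n≡n n≤m = sym (p≥q⇒p⊓q≡q (ℤ→ℚ-mono-≤ (ℤ.+≤+ n≤m)))

  Zigzag-ℤ→ℚ : ∀ z → Zigzag (ℤ→ℚ z) ≡ 0ℚ
  Zigzag-ℤ→ℚ z = begin
    (x - ℤ→ℚ (floor x)) ⊓ (ℤ→ℚ (ceiling x) - x)
      ≡⟨ cong₂ (λ f c → (x - ℤ→ℚ f) ⊓ (ℤ→ℚ c - x)) (floor-ℤ→ℚ z) (ceiling-ℤ→ℚ z) ⟩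
    (x - x) ⊓ (x - x)                           ≡⟨ cong (λ y → y ⊓ y) (+-inverseʳ x) ⟩
    0ℚ                                          ∎
    where
    open ≡-Reasoning
    x : ℚ
    x = ℤ→ℚ z

  Zigzag-ℤ→ℚ+ : ∀ z t → 0ℚ < t → t < 1ℚ → Zigzag (ℤ→ℚ z + t) ≡ t ⊓ (1ℚ - t)
  Zigzag-ℤ→ℚ+ z t 0<t t<1 = begin
    (x - ℤ→ℚ (floor x)) ⊓ (ℤ→ℚ (ceiling x) - x)
      ≡⟨ cong₂ (λ f c → (x - ℤ→ℚ f) ⊓ (ℤ→ℚ c - x)) ⌊x⌋≡z ⌈x⌉≡1+z ⟩
    (x - ℤ→ℚ z) ⊓ (ℤ→ℚ (ℤ.suc z) - x)            ≡⟨ cong (λ y → (x - ℤ→ℚ z) ⊓ (y - x)) ℤ→ℚ[1+z] ⟩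
    (ℤ→ℚ z + t - ℤ→ℚ z) ⊓ (1ℚ + ℤ→ℚ z - (ℤ→ℚ z + t))
      ≡⟨ cong₂ _⊓_ (solve 2 (λ z t → z :+ t :- z := t) refl (ℤ→ℚ z) t)
                   (solve 2 (λ z t → con 1ℚ :+ z :- (z :+ t) := con 1ℚ :- t) refl (ℤ→ℚ z) t) ⟩
    t ⊓ (1ℚ - t)                                  ∎
    where
    open ≡-Reasoning
    open QSolver.+-*-Solver
    x : ℚ
    x = ℤ→ℚ z + t
    ℤ→ℚ[1+z] : ℤ→ℚ (ℤ.suc z) ≡ 1ℚ + ℤ→ℚ z
    ℤ→ℚ[1+z] = ℤ→ℚ-homo-+ ℤ.1ℤ z
    z<x : ℤ→ℚ z < x
    z<x = subst (_< x) (+-identityʳ (ℤ→ℚ z)) (+-monoʳ-< (ℤ→ℚ z) 0<t)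
    x<1+z : x < ℤ→ℚ (ℤ.suc z)
    x<1+z = subst (x <_) (trans (+-comm (ℤ→ℚ z) 1ℚ) (sym ℤ→ℚ[1+z])) (+-monoʳ-< (ℤ→ℚ z) t<1)
    ⌊x⌋≡z : floor x ≡ z
    ⌊x⌋≡z = floor-unique z x (<⇒≤ z<x) x<1+z
    ⌈x⌉≡1+z : ceiling x ≡ ℤ.suc z
    ⌈x⌉≡1+z = ceiling-unique z x z<x (<⇒≤ x<1+z)

  pow2≡2^ : ∀ j → pow2 j ≡ ℕ→ℚ (2 ℕ.^ j)
  pow2≡2^ zero    = refl
  pow2≡2^ (suc j) = trans (cong (ℕ→ℚ 2 *_) (pow2≡2^ j)) (sym (ℕ→ℚ-homo-* 2 (2 ℕ.^ j)))

  pow2*pow½≡1 : ∀ j → pow2 j * pow½ j ≡ 1ℚ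
  pow2*pow½≡1 zero    = refl
  pow2*pow½≡1 (suc j) = trans
    (solve 4 (λ a p b h → (a :* p) :* (b :* h) := (a :* b) :* (p :* h)) refl (ℕ→ℚ 2) (pow2 j) ½ (pow½ j))
    (cong (ℕ→ℚ 2 * ½ *_) (pow2*pow½≡1 j))
    where open QSolver.+-*-Solver

  pow½-pos : ∀ j → Positive (pow½ j)
  pow½-pos zero    = _
  pow½-pos (suc j) = pos*pos⇒pos ½ (pow½ j) {{pow½-pos j}}

  pow2-pos : ∀ j → Positive (pow2 j)
  pow2-pos zero    = _
  pow2-pos (suc j) = pos*pos⇒pos (ℕ→ℚ 2) (pow2 j) {{pow2-pos j}}

  Zigzag-ℕ+dyadic : ∀ j q {r s} → r ℕ.+ s ≡ 2 ℕ.^ j → r ℕ.< 2 ℕ.^ j →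
    Zigzag (ℕ→ℚ q + ℕ→ℚ r * pow½ j) * pow2 j ≡ ℕ→ℚ (r ℕ.⊓ s)
  Zigzag-ℕ+dyadic j q {zero} _ _ = begin
    Zigzag (ℕ→ℚ q + 0ℚ * pow½ j) * pow2 j ≡⟨ cong (λ y → Zigzag (ℕ→ℚ q + y) * pow2 j) (*-zeroˡ (pow½ j)) ⟩
    Zigzag (ℕ→ℚ q + 0ℚ) * pow2 j          ≡⟨ cong (λ y → Zigzag y * pow2 j) (+-identityʳ (ℕ→ℚ q)) ⟩
    Zigzag (ℕ→ℚ q) * pow2 j               ≡⟨ cong (_* pow2 j) (Zigzag-ℤ→ℚ (+ q)) ⟩
    0ℚ * pow2 j                           ≡⟨ *-zeroˡ (pow2 j) ⟩
    0ℚ                                    ∎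
    where open ≡-Reasoning
  Zigzag-ℕ+dyadic j q {r@(suc _)} {s} r+s≡2^j r<2^j = begin
    Zigzag (ℕ→ℚ q + t) * P          ≡⟨ cong (_* P) (Zigzag-ℤ→ℚ+ (+ q) t 0<t t<1) ⟩
    (t ⊓ (1ℚ - t)) * P              ≡⟨ *-distribʳ-⊓-nonNeg P {{pos⇒nonNeg P {{pow2-pos j}}}} t (1ℚ - t) ⟩
    (t * P) ⊓ ((1ℚ - t) * P)        ≡⟨ cong₂ _⊓_ tP≡r [1-t]P≡s ⟩
    ℕ→ℚ r ⊓ ℕ→ℚ s                   ≡⟨ ℕ→ℚ-homo-⊓ r s ⟨
    ℕ→ℚ (r ℕ.⊓ s)                   ∎
    where
    open ≡-Reasoning
    open QSolver.+-*-Solver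
    h P t : ℚ
    h = pow½ j
    P = pow2 j
    t = ℕ→ℚ r * h
    hP≡1 : h * P ≡ 1ℚ
    hP≡1 = trans (*-comm h P) (pow2*pow½≡1 j)
    0<t : 0ℚ < t
    0<t = subst (_< t) (*-zeroˡ h)
            (*-monoˡ-<-pos h {{pow½-pos j}} (ℤ→ℚ-mono-< {+ 0} {+ r} (ℤ.+<+ (ℕ.s≤s ℕ.z≤n))))
    t<1 : t < 1ℚ
    t<1 = subst (t <_) (trans (cong (_* h) (sym (pow2≡2^ j))) (pow2*pow½≡1 j))
            (*-monoˡ-<-pos h {{pow½-pos j}} (ℤ→ℚ-mono-< {+ r} (ℤ.+<+ r<2^j)))
    tP≡r : t * P ≡ ℕ→ℚ r
    tP≡r = trans (*-assoc (ℕ→ℚ r) h P) (trans (cong (ℕ→ℚ r *_) hP≡1) (*-identityʳ (ℕ→ℚ r)))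
    r+s≡P : ℕ→ℚ r + ℕ→ℚ s ≡ P
    r+s≡P = trans (sym (ℕ→ℚ-homo-+ r s)) (trans (cong ℕ→ℚ r+s≡2^j) (sym (pow2≡2^ j)))
    [1-t]P≡s : (1ℚ - t) * P ≡ ℕ→ℚ s
    [1-t]P≡s = begin
      (1ℚ - t) * P               ≡⟨ solve 3 (λ r h p → (con 1ℚ :- r :* h) :* p := p :- r :* (h :* p)) refl (ℕ→ℚ r) h P ⟩
      P - ℕ→ℚ r * (h * P)        ≡⟨ cong (λ y → P - ℕ→ℚ r * y) hP≡1 ⟩
      P - ℕ→ℚ r * 1ℚ             ≡⟨ cong (λ y → y - ℕ→ℚ r * 1ℚ) r+s≡P ⟨
      ℕ→ℚ r + ℕ→ℚ s - ℕ→ℚ r * 1ℚ ≡⟨ solve 2 (λ r s → r :+ s :- r :* con 1ℚ := s) refl (ℕ→ℚ r) (ℕ→ℚ s) ⟩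
      ℕ→ℚ s                      ∎

  Zigzag-dyadic : ∀ j m → Zigzag (ℕ→ℚ m * pow½ j) * pow2 j ≡ ℕ→ℚ (dist2^ j m)
  Zigzag-dyadic j m = begin
    Zigzag (ℕ→ℚ m * h) * pow2 j               ≡⟨ cong (λ y → Zigzag y * pow2 j) m*h≡q+r*h ⟩
    Zigzag (ℕ→ℚ q + ℕ→ℚ r * h) * pow2 j       ≡⟨ Zigzag-ℕ+dyadic j q r+s≡2^j r<2^j ⟩
    ℕ→ℚ (r ℕ.⊓ s)                              ≡⟨ cong ℕ→ℚ (dist2^-spec j q r+s≡2^j) ⟨
    ℕ→ℚ (dist2^ j (q ℕ.* 2 ℕ.^ j ℕ.+ r))       ≡⟨ cong (ℕ→ℚ ∘ dist2^ j) m≡q*2^j+r ⟨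
    ℕ→ℚ (dist2^ j m)                           ∎
    where
    open ≡-Reasoning
    open QSolver.+-*-Solver
    instance
      2^j≢0 : ℕ.NonZero (2 ℕ.^ j)
      2^j≢0 = ℕP.m^n≢0 2 j
    h : ℚ
    h = pow½ j
    q r s : ℕ
    q = m / 2 ℕ.^ j
    r = m % 2 ℕ.^ j
    s = 2 ℕ.^ j ℕ.∸ r
    r<2^j : r ℕ.< 2 ℕ.^ j
    r<2^j = m%n<n m (2 ℕ.^ j)
    r+s≡2^j : r ℕ.+ s ≡ 2 ℕ.^ j
    r+s≡2^j = ℕP.m+[n∸m]≡n (ℕP.<⇒≤ r<2^j)
    m≡q*2^j+r : m ≡ q ℕ.* 2 ℕ.^ j ℕ.+ r
    m≡q*2^j+r = trans (m≡m%n+[m/n]*n m (2 ℕ.^ j)) (ℕP.+-comm r (q ℕ.* 2 ℕ.^ j))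
    m*h≡q+r*h : ℕ→ℚ m * h ≡ ℕ→ℚ q + ℕ→ℚ r * h
    m*h≡q+r*h = begin
      ℕ→ℚ m * h                             ≡⟨ cong (λ n → ℕ→ℚ n * h) m≡q*2^j+r ⟩
      ℕ→ℚ (q ℕ.* 2 ℕ.^ j ℕ.+ r) * h          ≡⟨ cong (_* h) (ℕ→ℚ-homo-+ (q ℕ.* 2 ℕ.^ j) r) ⟩
      (ℕ→ℚ (q ℕ.* 2 ℕ.^ j) + ℕ→ℚ r) * h      ≡⟨ cong (λ u → (u + ℕ→ℚ r) * h) (ℕ→ℚ-homo-* q (2 ℕ.^ j)) ⟩
      (ℕ→ℚ q * ℕ→ℚ (2 ℕ.^ j) + ℕ→ℚ r) * h    ≡⟨ cong (λ p → (ℕ→ℚ q * p + ℕ→ℚ r) * h) (pow2≡2^ j) ⟨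
      (ℕ→ℚ q * pow2 j + ℕ→ℚ r) * h
        ≡⟨ solve 4 (λ q p r h → (q :* p :+ r) :* h := q :* (p :* h) :+ r :* h) refl (ℕ→ℚ q) (pow2 j) (ℕ→ℚ r) h ⟩
      ℕ→ℚ q * (pow2 j * h) + ℕ→ℚ r * h       ≡⟨ cong (λ u → ℕ→ℚ q * u + ℕ→ℚ r * h) (pow2*pow½≡1 j) ⟩
      ℕ→ℚ q * 1ℚ + ℕ→ℚ r * h                 ≡⟨ cong (_+ ℕ→ℚ r * h) (*-identityʳ (ℕ→ℚ q)) ⟩
      ℕ→ℚ q + ℕ→ℚ r * h                      ∎

  takagiPartial-suc : ∀ N x → takagiPartial (suc N) x ≡ Zigzag x + ½ * takagiPartial N (ℕ→ℚ 2 * x)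
  takagiPartial-suc zero x = begin
    0ℚ + 1ℚ * Zigzag (1ℚ * x) ≡⟨ cong (λ y → 0ℚ + 1ℚ * Zigzag y) (*-identityˡ x) ⟩
    0ℚ + 1ℚ * Zigzag x        ≡⟨ solve 1 (λ z → con 0ℚ :+ con 1ℚ :* z := z :+ con ½ :* con 0ℚ) refl (Zigzag x) ⟩
    Zigzag x + ½ * 0ℚ         ∎
    where
    open ≡-Reasoning
    open QSolver.+-*-Solver
  takagiPartial-suc (suc N) x = begin
    takagiPartial (suc N) x + ½ * pow½ N * Zigzag (ℕ→ℚ 2 * pow2 N * x)
      ≡⟨ cong₂ (λ t y → t + ½ * pow½ N * Zigzag y) (takagiPartial-suc N x)
               (solve 3 (λ a p x → a :* p :* x := p :* (a :* x)) refl (ℕ→ℚ 2) (pow2 N) x) ⟩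
    Zigzag x + ½ * T + ½ * pow½ N * Zigzag (pow2 N * (ℕ→ℚ 2 * x))
      ≡⟨ solve 4 (λ z t h w → z :+ con ½ :* t :+ con ½ :* h :* w := z :+ con ½ :* (t :+ h :* w)) refl
           (Zigzag x) T (pow½ N) (Zigzag (pow2 N * (ℕ→ℚ 2 * x))) ⟩
    Zigzag x + ½ * (T + pow½ N * Zigzag (pow2 N * (ℕ→ℚ 2 * x))) ∎
    where
    open ≡-Reasoning
    open QSolver.+-*-Solver
    T : ℚ
    T = takagiPartial N (ℕ→ℚ 2 * x)

  takagiPartial-ℤ→ℚ : ∀ N z → takagiPartial N (ℤ→ℚ z) ≡ 0ℚ
  takagiPartial-ℤ→ℚ zero    z = refl
  takagiPartial-ℤ→ℚ (suc N) z = begin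
    takagiPartial N (ℤ→ℚ z) + pow½ N * Zigzag (pow2 N * ℤ→ℚ z)
      ≡⟨ cong₂ (λ t y → t + pow½ N * Zigzag y) (takagiPartial-ℤ→ℚ N z) 2^N*z≡ ⟩
    0ℚ + pow½ N * Zigzag (ℤ→ℚ (+ (2 ℕ.^ N) ℤ.* z))
      ≡⟨ cong (λ y → 0ℚ + pow½ N * y) (Zigzag-ℤ→ℚ (+ (2 ℕ.^ N) ℤ.* z)) ⟩
    0ℚ + pow½ N * 0ℚ
      ≡⟨ trans (+-identityˡ (pow½ N * 0ℚ)) (*-zeroʳ (pow½ N)) ⟩
    0ℚ ∎
    where
    open ≡-Reasoning
    2^N*z≡ : pow2 N * ℤ→ℚ z ≡ ℤ→ℚ (+ (2 ℕ.^ N) ℤ.* z)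
    2^N*z≡ = trans (cong (_* ℤ→ℚ z) (pow2≡2^ N)) (sym (ℤ→ℚ-homo-* (+ (2 ℕ.^ N)) z))

  takagiPartial-dyadic : ∀ {k N} n → k ℕ.≤ N →
    takagiPartial N (ℕ→ℚ n * pow½ k) * pow2 k ≡ ℕ→ℚ (scaledTakagi k n)
  takagiPartial-dyadic {zero} {N} n _ = begin
    takagiPartial N (ℕ→ℚ n * 1ℚ) * 1ℚ ≡⟨ *-identityʳ _ ⟩
    takagiPartial N (ℕ→ℚ n * 1ℚ)      ≡⟨ cong (takagiPartial N) (*-identityʳ (ℕ→ℚ n)) ⟩
    takagiPartial N (ℕ→ℚ n)           ≡⟨ takagiPartial-ℤ→ℚ N (+ n) ⟩
    0ℚ                                ∎
    where open ≡-Reasoning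
  takagiPartial-dyadic {suc k} {suc N} n (ℕ.s≤s k≤N) = begin
    takagiPartial (suc N) x * (ℕ→ℚ 2 * pow2 k)
      ≡⟨ cong (_* (ℕ→ℚ 2 * pow2 k)) (takagiPartial-suc N x) ⟩
    (Zigzag x + ½ * takagiPartial N (ℕ→ℚ 2 * x)) * (ℕ→ℚ 2 * pow2 k)
      ≡⟨ solve 3 (λ z t p → (z :+ con ½ :* t) :* (con (ℕ→ℚ 2) :* p) := z :* (con (ℕ→ℚ 2) :* p) :+ t :* p) refl
           (Zigzag x) (takagiPartial N (ℕ→ℚ 2 * x)) (pow2 k) ⟩
    Zigzag x * pow2 (suc k) + takagiPartial N (ℕ→ℚ 2 * x) * pow2 k
      ≡⟨ cong₂ _+_ (Zigzag-dyadic (suc k) n)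
                   (trans (cong (λ y → takagiPartial N y * pow2 k) 2x≡) (takagiPartial-dyadic n k≤N)) ⟩
    ℕ→ℚ (dist2^ (suc k) n) + ℕ→ℚ (scaledTakagi k n)
      ≡⟨ +-comm (ℕ→ℚ (dist2^ (suc k) n)) (ℕ→ℚ (scaledTakagi k n)) ⟩
    ℕ→ℚ (scaledTakagi k n) + ℕ→ℚ (dist2^ (suc k) n)
      ≡⟨ ℕ→ℚ-homo-+ (scaledTakagi k n) (dist2^ (suc k) n) ⟨
    ℕ→ℚ (scaledTakagi (suc k) n) ∎
    where
    open ≡-Reasoning
    open QSolver.+-*-Solver
    x : ℚ
    x = ℕ→ℚ n * pow½ (suc k)
    2x≡ : ℕ→ℚ 2 * x ≡ ℕ→ℚ n * pow½ k
    2x≡ = solve 2 (λ n h → con (ℕ→ℚ 2) :* (n :* (con ½ :* h)) := n :* h) refl (ℕ→ℚ n) (pow½ k)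

  n*k-2B≡scaledTakagi : ∀ {k} n → n ℕ.≤ 2 ℕ.^ k → + (n ℕ.* k) ℤ.- + (2 ℕ.* B n) ≡ + scaledTakagi k n
  n*k-2B≡scaledTakagi {k} n n≤2^k = begin
    + (n ℕ.* k) ℤ.- + (2 ℕ.* B n)     ≡⟨ ℤP.[+m]-[+n]≡m⊖n (n ℕ.* k) (2 ℕ.* B n) ⟩
    n ℕ.* k ℤ.⊖ 2 ℕ.* B n              ≡⟨ cong (ℤ._⊖ 2 ℕ.* B n) (scaledTakagi+2B≡n*k k n n≤2^k) ⟨
    T ℕ.+ 2 ℕ.* B n ℤ.⊖ 2 ℕ.* B n      ≡⟨ ℤP.⊖-≥ (ℕP.m≤n+m (2 ℕ.* B n) T) ⟩
    + (T ℕ.+ 2 ℕ.* B n ℕ.∸ 2 ℕ.* B n)  ≡⟨ cong +_ (ℕP.m+n∸n≡m T (2 ℕ.* B n)) ⟩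
    + T                               ∎
    where
    open ≡-Reasoning
    T : ℕ
    T = scaledTakagi k n

  takagiPartial-exact : ∀ {k N} n → k ℕ.≤ N → n ℕ.≤ 2 ℕ.^ k →
    takagiPartial N (ℕ→ℚ n * pow½ k) ≡ ℤ→ℚ (+ (n ℕ.* k) ℤ.- + (2 ℕ.* B n)) * pow½ k
  takagiPartial-exact {k} {N} n k≤N n≤2^k = begin
    F                                ≡⟨ *-identityʳ F ⟨
    F * 1ℚ                           ≡⟨ cong (F *_) (pow2*pow½≡1 k) ⟨
    F * (pow2 k * pow½ k)            ≡⟨ *-assoc F (pow2 k) (pow½ k) ⟨
    F * pow2 k * pow½ k              ≡⟨ cong (_* pow½ k) (takagiPartial-dyadic n k≤N) ⟩
    ℕ→ℚ (scaledTakagi k n) * pow½ k  ≡⟨ cong (λ z → ℤ→ℚ z * pow½ k) (n*k-2B≡scaledTakagi n n≤2^k) ⟨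
    ℤ→ℚ (+ (n ℕ.* k) ℤ.- + (2 ℕ.* B n)) * pow½ k ∎
    where
    open ≡-Reasoning
    F : ℚ
    F = takagiPartial N (ℕ→ℚ n * pow½ k)

open import Data.Nat as ℕ using (ℕ; _≤_; _^_)
open import Data.Integer as ℤ using (+_)
open import Data.Rational using (ℚ; _-_; _*_; _<_; ∣_∣; 0ℚ)
open import Data.Product using (∃-syntax; _,_)
open import Relation.Binary.PropositionalEquality using (_≡_; sym; trans; cong; subst)
open import Data.Rational.Properties using (+-inverseʳ)
open TakagiPartialSums using (takagiPartial-exact)

theorem4p1 : ∀ (n k : ℕ) → 1 ≤ n → n ≤ 2 ^ k →
    ∀ (ε : ℚ) → 0ℚ < ε → ∃[ N₀ ] ∀ N → N₀ ≤ N →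
      ∣ takagiPartial N (ℕ→ℚ n * pow½ k)
        - (ℤ→ℚ (+ (n ℕ.* k) ℤ.- + (2 ℕ.* B n)) * pow½ k) ∣ < ε
theorem4p1 n k _ n≤2^k ε 0<ε = k , λ N k≤N → subst (_< ε) (sym (∣F-v∣≡0 N k≤N)) 0<ε
  where
  v : ℚ
  v = ℤ→ℚ (+ (n ℕ.* k) ℤ.- + (2 ℕ.* B n)) * pow½ k
  ∣F-v∣≡0 : ∀ N → k ≤ N → ∣ takagiPartial N (ℕ→ℚ n * pow½ k) - v ∣ ≡ 0ℚ
  ∣F-v∣≡0 N k≤N = cong ∣_∣ (trans (cong (_- v) (takagiPartial-exact n k≤N n≤2^k)) (+-inverseʳ v))
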